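{- Let $G$ and $H$ be finite simple graphs with $\operatorname{im}(G)=t$ and $\operatorname{im}(H)=r$. Then $\operatorname{im}(G\,\Box\, H)\geq t+r-1$.
   Context: All graphs are finite and simple. A graph $G$ has a $G'$-immersion if there is an injective map $\phi:V(G')\to V(G)$ such that for every edge $uv\in E(G')$ there is a path in $G$ joining $\phi(u)$ and $\phi(v)$, and these paths are pairwise edge-disjoint. The immersion number $\operatorname{im}(G)$ is the largest $t$ such that $G$ has a $K_t$-immersion. The Cartesian product $G\,\Box\, H$ has vertex set $V(G)\times V(H)$, with $(g,h)$ adjacent to $(g',h')$ if and only if either $g=g'$ and $hh'\in E(H)$, or $gg'\in E(G)$ and $h=h'$. -}

module Defs where

open import Level using (0ℓ)
open import Data.Nat using (ℕ; _*_)
open import Data.Fin using (Fin; _<_)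
open import Data.Fin.Properties using (*↔×)
open import Data.Product using (Σ; Σ-syntax; _×_; _,_; proj₁; proj₂)
open import Data.Sum using (_⊎_; inj₁; inj₂)
open import Data.List using (List; []; _∷_)
open import Data.List.Membership.Propositional using (_∈_)
open import Data.List.Relation.Unary.Unique.Propositional using (Unique)
open import Data.Empty using (⊥)
open import Function using (_↔_)
open import Function.Definitions using (Injective)
open import Function.Properties.Inverse using (↔-trans; ↔-sym)
open import Data.Product.Function.NonDependent.Propositional using (_×-↔_)
open import Relation.Binary.PropositionalEquality using (_≡_)
open import Relation.Nullary using (¬_)

record Graph : Set₁ where
  field
    V      : Set
    size   : ℕ
    finite : V ↔ Fin size
    Adj    : V → V → Set
    sym    : ∀ {u v} → Adj u v → Adj v u
    irrefl : ∀ {v} → ¬ Adj v v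

open Graph public

_□_ : Graph → Graph → Graph
G □ H = record
  { V      = V G × V H
  ; size   = size G * size H
  ; finite = ↔-trans (finite G ×-↔ finite H) (↔-sym *↔×)
  ; Adj    = λ { (g , h) (g' , h') →
               (g ≡ g' × Adj H h h') ⊎ (Adj G g g' × h ≡ h') }
  ; sym    = λ { (inj₁ (e , a)) → inj₁ (Data.Product.map₁ Relation.Binary.PropositionalEquality.sym (e , Graph.sym H a) )
               ; (inj₂ (a , e)) → inj₂ (Graph.sym G a , Relation.Binary.PropositionalEquality.sym e) }
  ; irrefl = λ { (inj₁ (_ , a)) → Graph.irrefl H a
               ; (inj₂ (a , _)) → Graph.irrefl G a }
  }

module _ (G : Graph) where

  data Walk : V G → V G → Set where
    here : ∀ {u} → Walk u u
    step : ∀ {u w v} → Adj G u w → Walk w v → Walk u v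

  vertices : ∀ {u v} → Walk u v → List (V G)
  vertices {u} here       = u ∷ []
  vertices {u} (step _ p) = u ∷ vertices p

  edges : ∀ {u v} → Walk u v → List (V G × V G)
  edges here                 = []
  edges {u} (step {w = w} _ p) = (u , w) ∷ edges p

  IsPath : ∀ {u v} → Walk u v → Set
  IsPath p = Unique (vertices p)

  SameEdge : V G × V G → V G × V G → Set
  SameEdge (a , b) (c , d) = (a ≡ c × b ≡ d) ⊎ (a ≡ d × b ≡ c)

  EdgeDisjoint : ∀ {u v u' v'} → Walk u v → Walk u' v' → Set
  EdgeDisjoint p q = ∀ {e e'} → e ∈ edges p → e' ∈ edges q → ¬ SameEdge e e'

  HasImmersion : ℕ → Set
  HasImmersion t =
    Σ[ φ ∈ (Fin t → V G) ] Injective _≡_ _≡_ φ ×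
    Σ[ P ∈ ((i j : Fin t) → i < j → Walk (φ i) (φ j)) ]
      ((∀ i j (i<j : i < j) → IsPath (P i j i<j)) ×
       (∀ i j k l (i<j : i < j) (k<l : k < l) →
          ¬ (i ≡ k × j ≡ l) → EdgeDisjoint (P i j i<j) (P k l k<l)))

  ImmersionNumber : ℕ → Set
  ImmersionNumber t = HasImmersion t × (∀ s → HasImmersion s → s Data.Nat.≤ t)

module Submission where

-- Let φ₀ … φₜ be the branch vertices of a K_{t+1}-immersion in G (paths P)
-- and ψ₀ … ψᵣ those of a K_{r+1}-immersion in H (paths Q), and let top be
-- the last G-index.  In G □ H take the t + 1 + r branch vertices (φₐ , ψ₀)
-- and (φ_top , ψ_{b+1}); join two of the first kind by P in the row of ψ₀,
-- two of the second kind by Q in the column of φ_top, and (φₐ , ψ₀) to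
-- (φ_top , ψ_{b+1}) by the L-shaped bridge that goes along Q₀,b+1 in the
-- column of φₐ and then along Pₐ,top in the row of ψ_{b+1}.  These paths are
-- edge-disjoint since row edges are never column edges, and two row (column)
-- pieces can share an edge only in the same row (column) and from the same
-- G-path (H-path).

open import Defs
open import Data.Nat using (ℕ; zero; suc; _+_; _∸_; _≤_; _>_; z<s; s<s)
open import Data.Nat.Properties using (+-suc)
open import Data.Fin as Fin using (Fin; fromℕ; fromℕ<; splitAt; join)
open import Data.Fin.Properties
  using (suc-injective; 0≢1+n; ≤fromℕ; ≤∧≢⇒<; join-splitAt)
open import Data.Product using (Σ; _×_; _,_; proj₁; proj₂)
open import Data.Sum using (_⊎_; inj₁; inj₂; map₁)
open import Data.Sum.Relation.Binary.LeftOrder using (_⊎-<_; ₁∼₂; ₁∼₁; ₂∼₂)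
open import Data.Empty using (⊥; ⊥-elim)
open import Data.List using (List; []; _∷_; _++_; map)
open import Data.List.Membership.Propositional using (_∈_; _∉_)
open import Data.List.Membership.Propositional.Properties using (∈-map⁻; ∈-++⁻)
open import Data.List.Relation.Unary.Unique.Propositional using (Unique)
open import Data.List.Relation.Unary.Unique.Propositional.Properties
  using (map⁺; ++⁺; Unique[x∷xs]⇒x∉xs)
open import Data.List.Relation.Unary.All using ([])
open import Data.List.Relation.Unary.AllPairs using ([]; _∷_)
open import Data.List.Relation.Unary.Any using (here; there)
open import Function using (Inverse; _∘_)
open import Function.Definitions using (Injective)
open import Relation.Binary.PropositionalEquality
  using (_≡_; _≢_; refl; cong; subst; module ≡-Reasoning)
  renaming (sym to ≡-sym)
open import Relation.Nullary using (¬_; yes; no)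

module _ (K : Graph) where

  _++ʷ_ : ∀ {u v w} → Walk K u v → Walk K v w → Walk K u w
  here     ++ʷ q = q
  step a p ++ʷ q = step a (p ++ʷ q)

  tailVertices : ∀ {u v} → Walk K u v → List (V K)
  tailVertices here       = []
  tailVertices (step _ p) = vertices K p

  vertices-++ : ∀ {u v w} (p : Walk K u v) (q : Walk K v w) →
    vertices K (p ++ʷ q) ≡ vertices K p ++ tailVertices q
  vertices-++ here       here       = refl
  vertices-++ here       (step _ _) = refl
  vertices-++ (step _ p) q          = cong (_ ∷_) (vertices-++ p q)

  edges-++ : ∀ {u v w} (p : Walk K u v) (q : Walk K v w) →
    edges K (p ++ʷ q) ≡ edges K p ++ edges K q
  edges-++ here       q = refl
  edges-++ (step _ p) q = cong (_ ∷_) (edges-++ p q)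

  edge-adjacent : ∀ {u v e} (p : Walk K u v) → e ∈ edges K p →
    Adj K (proj₁ e) (proj₂ e)
  edge-adjacent (step a p) (here refl) = a
  edge-adjacent (step a p) (there e∈p) = edge-adjacent p e∈p

  here-isPath : ∀ {u} → IsPath K (here {u = u})
  here-isPath = [] ∷ []

  start∉tailVertices : ∀ {u v} (p : Walk K u v) → IsPath K p →
    u ∉ tailVertices p
  start∉tailVertices here       _  ()
  start∉tailVertices (step _ p) up = Unique[x∷xs]⇒x∉xs up

  tailVertices-unique : ∀ {u v} (p : Walk K u v) → IsPath K p →
    Unique (tailVertices p)
  tailVertices-unique here       _        = []
  tailVertices-unique (step _ p) (_ ∷ up) = up

  ++-isPath : ∀ {u v w} (p : Walk K u v) (q : Walk K v w) →
    IsPath K p → IsPath K q →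
    (∀ {x} → x ∈ vertices K p → x ∈ tailVertices q → ⊥) →
    IsPath K (p ++ʷ q)
  ++-isPath p q pp qp apart =
    subst Unique (≡-sym (vertices-++ p q))
      (++⁺ pp (tailVertices-unique q qp) λ (x∈p , x∈q) → apart x∈p x∈q)

  SameEdge-sym : ∀ {e e'} → SameEdge K e e' → SameEdge K e' e
  SameEdge-sym (inj₁ (refl , refl)) = inj₁ (refl , refl)
  SameEdge-sym (inj₂ (refl , refl)) = inj₂ (refl , refl)

  EdgeDisjoint-sym : ∀ {u v u' v'} (p : Walk K u v) (q : Walk K u' v') →
    EdgeDisjoint K p q → EdgeDisjoint K q p
  EdgeDisjoint-sym p q disj e∈q e'∈p same = disj e'∈p e∈q (SameEdge-sym same)

  ++-disjointˡ : ∀ {u v w a b} (p : Walk K u v) (q : Walk K v w)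
    (r : Walk K a b) → EdgeDisjoint K p r → EdgeDisjoint K q r →
    EdgeDisjoint K (p ++ʷ q) r
  ++-disjointˡ p q r pr qr e∈pq
    with ∈-++⁻ (edges K p) (subst (_ ∈_) (edges-++ p q) e∈pq)
  ... | inj₁ e∈p = pr e∈p
  ... | inj₂ e∈q = qr e∈q

  ++-disjointʳ : ∀ {u v w a b} (r : Walk K a b) (p : Walk K u v)
    (q : Walk K v w) → EdgeDisjoint K r p → EdgeDisjoint K r q →
    EdgeDisjoint K r (p ++ʷ q)
  ++-disjointʳ r p q rp rq =
    EdgeDisjoint-sym (p ++ʷ q) r
      (++-disjointˡ p q r (EdgeDisjoint-sym r p rp) (EdgeDisjoint-sym r q rq))

module Product (G H : Graph) where

  inRow : ∀ {x x'} (y : V H) → Walk G x x' → Walk (G □ H) (x , y) (x' , y)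
  inRow y here       = here
  inRow y (step a p) = step (inj₂ (a , refl)) (inRow y p)

  inColumn : ∀ {y y'} (x : V G) → Walk H y y' → Walk (G □ H) (x , y) (x , y')
  inColumn x here       = here
  inColumn x (step a q) = step (inj₁ (refl , a)) (inColumn x q)

  rowEdge : V H → V G × V G → V (G □ H) × V (G □ H)
  rowEdge y (a , b) = ((a , y) , (b , y))

  columnEdge : V G → V H × V H → V (G □ H) × V (G □ H)
  columnEdge x (c , d) = ((x , c) , (x , d))

  vertices-inRow : ∀ {x x'} y (p : Walk G x x') →
    vertices (G □ H) (inRow y p) ≡ map (_, y) (vertices G p)
  vertices-inRow y here       = refl
  vertices-inRow y (step _ p) = cong (_ ∷_) (vertices-inRow y p)

  tailVertices-inRow : ∀ {x x'} y (p : Walk G x x') →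
    tailVertices (G □ H) (inRow y p) ≡ map (_, y) (tailVertices G p)
  tailVertices-inRow y here       = refl
  tailVertices-inRow y (step _ p) = vertices-inRow y p

  vertices-inColumn : ∀ {y y'} x (q : Walk H y y') →
    vertices (G □ H) (inColumn x q) ≡ map (x ,_) (vertices H q)
  vertices-inColumn x here       = refl
  vertices-inColumn x (step _ q) = cong (_ ∷_) (vertices-inColumn x q)

  edges-inRow : ∀ {x x'} y (p : Walk G x x') →
    edges (G □ H) (inRow y p) ≡ map (rowEdge y) (edges G p)
  edges-inRow y here       = refl
  edges-inRow y (step _ p) = cong (_ ∷_) (edges-inRow y p)

  edges-inColumn : ∀ {y y'} x (q : Walk H y y') →
    edges (G □ H) (inColumn x q) ≡ map (columnEdge x) (edges H q)
  edges-inColumn x here       = refl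
  edges-inColumn x (step _ q) = cong (_ ∷_) (edges-inColumn x q)

  inRow-isPath : ∀ {x x'} y (p : Walk G x x') → IsPath G p →
    IsPath (G □ H) (inRow y p)
  inRow-isPath y p pp =
    subst Unique (≡-sym (vertices-inRow y p)) (map⁺ (cong proj₁) pp)

  inColumn-isPath : ∀ {y y'} x (q : Walk H y y') → IsPath H q →
    IsPath (G □ H) (inColumn x q)
  inColumn-isPath x q qp =
    subst Unique (≡-sym (vertices-inColumn x q)) (map⁺ (cong proj₂) qp)

  -- An L-shaped walk, first along a column path and then along a row path,
  -- is a path: the two parts can only meet in the column of the start of
  -- the row path, which the row path does not revisit.
  corner-isPath : ∀ {x x' y y'} (q : Walk H y y') (p : Walk G x x') →
    IsPath H q → IsPath G p →
    IsPath (G □ H) (_++ʷ_ (G □ H) (inColumn x q) (inRow y' p))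
  corner-isPath {x} q p qp pp =
    ++-isPath (G □ H) (inColumn x q) (inRow _ p)
      (inColumn-isPath x q qp) (inRow-isPath _ p pp) apart
    where
    apart : ∀ {v} → v ∈ vertices (G □ H) (inColumn x q) →
      v ∈ tailVertices (G □ H) (inRow _ p) → ⊥
    apart v∈q v∈p
      with ∈-map⁻ _ (subst (_ ∈_) (vertices-inColumn x q) v∈q)
         | ∈-map⁻ _ (subst (_ ∈_) (tailVertices-inRow _ p) v∈p)
    ... | _ , _ , refl | x″ , x″∈p , refl = start∉tailVertices G p pp x″∈p

  inRow-edge⁻ : ∀ {x x' e} y (p : Walk G x x') →
    e ∈ edges (G □ H) (inRow y p) →
    Σ (V G × V G) λ e₀ → e₀ ∈ edges G p × e ≡ rowEdge y e₀
  inRow-edge⁻ y p e∈p = ∈-map⁻ _ (subst (_ ∈_) (edges-inRow y p) e∈p)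

  inColumn-edge⁻ : ∀ {y y' e} x (q : Walk H y y') →
    e ∈ edges (G □ H) (inColumn x q) →
    Σ (V H × V H) λ e₀ → e₀ ∈ edges H q × e ≡ columnEdge x e₀
  inColumn-edge⁻ x q e∈q = ∈-map⁻ _ (subst (_ ∈_) (edges-inColumn x q) e∈q)

  rowEdge≢columnEdge : ∀ {y x a b c d} → Adj G a b →
    ¬ SameEdge (G □ H) (rowEdge y (a , b)) (columnEdge x (c , d))
  rowEdge≢columnEdge ab (inj₁ (refl , refl)) = irrefl G ab
  rowEdge≢columnEdge ab (inj₂ (refl , refl)) = irrefl G ab

  sameRowEdge : ∀ {y y' e e'} →
    SameEdge (G □ H) (rowEdge y e) (rowEdge y' e') → y ≡ y' × SameEdge G e e'
  sameRowEdge (inj₁ (refl , refl)) = refl , inj₁ (refl , refl)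
  sameRowEdge (inj₂ (refl , refl)) = refl , inj₂ (refl , refl)

  sameColumnEdge : ∀ {x x' e e'} →
    SameEdge (G □ H) (columnEdge x e) (columnEdge x' e') →
    x ≡ x' × SameEdge H e e'
  sameColumnEdge (inj₁ (refl , refl)) = refl , inj₁ (refl , refl)
  sameColumnEdge (inj₂ (refl , refl)) = refl , inj₂ (refl , refl)

  rows-disjoint : ∀ {x₁ x₂ x₃ x₄ y y'} (p : Walk G x₁ x₂) (p' : Walk G x₃ x₄) →
    (y ≡ y' → EdgeDisjoint G p p') →
    EdgeDisjoint (G □ H) (inRow y p) (inRow y' p')
  rows-disjoint p p' disj e∈p e'∈p' same
    with inRow-edge⁻ _ p e∈p | inRow-edge⁻ _ p' e'∈p'
  ... | _ , e₀∈p , refl | _ , e₀'∈p' , refl with sameRowEdge same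
  ... | refl , same₀ = disj refl e₀∈p e₀'∈p' same₀

  columns-disjoint : ∀ {y₁ y₂ y₃ y₄ x x'} (q : Walk H y₁ y₂) (q' : Walk H y₃ y₄) →
    (x ≡ x' → EdgeDisjoint H q q') →
    EdgeDisjoint (G □ H) (inColumn x q) (inColumn x' q')
  columns-disjoint q q' disj e∈q e'∈q' same
    with inColumn-edge⁻ _ q e∈q | inColumn-edge⁻ _ q' e'∈q'
  ... | _ , e₀∈q , refl | _ , e₀'∈q' , refl with sameColumnEdge same
  ... | refl , same₀ = disj refl e₀∈q e₀'∈q' same₀

  row-column-disjoint : ∀ {x x' y y' a b} (p : Walk G x x') (q : Walk H y y') →
    EdgeDisjoint (G □ H) (inRow a p) (inColumn b q)
  row-column-disjoint p q e∈p e'∈q same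
    with inRow-edge⁻ _ p e∈p | inColumn-edge⁻ _ q e'∈q
  ... | _ , e₀∈p , refl | _ , _ , refl =
    rowEdge≢columnEdge (edge-adjacent G p e₀∈p) same

-- An immersion of the complete graph on an index set I, where _≺_ selects
-- one orientation of every pair of distinct indices.  HasImmersion K t is
-- exactly the case I = Fin t ordered by _<_.
record Immersion (K : Graph) (I : Set) (_≺_ : I → I → Set) : Set where
  field
    branch    : I → V K
    injective : Injective _≡_ _≡_ branch
    path      : ∀ i j → i ≺ j → Walk K (branch i) (branch j)
    isPath    : ∀ i j (i≺j : i ≺ j) → IsPath K (path i j i≺j)
    disjoint  : ∀ i j k l (i≺j : i ≺ j) (k≺l : k ≺ l) → ¬ (i ≡ k × j ≡ l) →
                EdgeDisjoint K (path i j i≺j) (path k l k≺l)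

fromHasImmersion : ∀ {K t} → HasImmersion K t → Immersion K (Fin t) Fin._<_
fromHasImmersion (φ , φ-inj , P , P-path , P-disj) =
  record { branch = φ ; injective = φ-inj ; path = P
         ; isPath = P-path ; disjoint = P-disj }

toHasImmersion : ∀ {K t} → Immersion K (Fin t) Fin._<_ → HasImmersion K t
toHasImmersion I = branch , injective , path , isPath , disjoint
  where open Immersion I

reindex : ∀ {K I J} {_≺_ : I → I → Set} {_⊏_ : J → J → Set} (f : J → I) →
  Injective _≡_ _≡_ f → (∀ {i j} → i ⊏ j → f i ≺ f j) →
  Immersion K I _≺_ → Immersion K J _⊏_
reindex f f-inj f-mono I = record
  { branch    = branch ∘ f
  ; injective = f-inj ∘ injective
  ; path      = λ i j i⊏j → path (f i) (f j) (f-mono i⊏j)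
  ; isPath    = λ i j i⊏j → isPath (f i) (f j) (f-mono i⊏j)
  ; disjoint  = λ i j k l i⊏j k⊏l distinct →
      disjoint (f i) (f j) (f k) (f l) (f-mono i⊏j) (f-mono k⊏l)
        λ (fi≡fk , fj≡fl) → distinct (f-inj fi≡fk , f-inj fj≡fl)
  }
  where open Immersion I

splitAt-injective : ∀ m {n} → Injective _≡_ _≡_ (splitAt m {n})
splitAt-injective m {n} {k} {l} eq = begin
  k                      ≡⟨ ≡-sym (join-splitAt m n k) ⟩
  join m n (splitAt m k) ≡⟨ cong (join m n) eq ⟩
  join m n (splitAt m l) ≡⟨ join-splitAt m n l ⟩
  l                      ∎
  where open ≡-Reasoning

_<⊎_ : ∀ {m n} → Fin m ⊎ Fin n → Fin m ⊎ Fin n → Set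
_<⊎_ = Fin._<_ ⊎-< Fin._<_

splitAt-monotone : ∀ m {n} {k l : Fin (m + n)} → k Fin.< l →
  splitAt m k <⊎ splitAt m l
splitAt-monotone zero    k<l = ₂∼₂ k<l
splitAt-monotone (suc m) {k = Fin.zero} {Fin.suc l} _ = zero-least (splitAt m l)
  where
  zero-least : ∀ {n} (x : Fin m ⊎ Fin n) → inj₁ Fin.zero <⊎ map₁ Fin.suc x
  zero-least (inj₁ _) = ₁∼₁ z<s
  zero-least (inj₂ _) = ₁∼₂
splitAt-monotone (suc m) {k = Fin.suc k} {Fin.suc l} (s<s k<l) =
  suc-monotone (splitAt-monotone m k<l)
  where
  suc-monotone : ∀ {n} {x y : Fin m ⊎ Fin n} → x <⊎ y →
    map₁ Fin.suc x <⊎ map₁ Fin.suc y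
  suc-monotone ₁∼₂          = ₁∼₂
  suc-monotone (₁∼₁ x<y)    = ₁∼₁ (s<s x<y)
  suc-monotone (₂∼₂ x<y)    = ₂∼₂ x<y

K₁-immersion : ∀ K → size K > 0 → HasImmersion K 1
K₁-immersion K nonempty =
  (λ _ → v) , (λ { {Fin.zero} {Fin.zero} _ → refl })
  , (λ { Fin.zero Fin.zero () }) , (λ { Fin.zero Fin.zero () })
  , (λ { Fin.zero Fin.zero _ _ () })
  where
  v : V K
  v = Inverse.from (finite K) (fromℕ< nonempty)

module Construction {G H : Graph} {t r : ℕ}
  (IG : Immersion G (Fin (suc t)) Fin._<_)
  (IH : Immersion H (Fin (suc r)) Fin._<_) where

  open Product G H
  open Immersion IG using ()
    renaming (branch to φ; injective to φ-injective; path to P;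
              isPath to P-isPath; disjoint to P-disjoint)
  open Immersion IH using ()
    renaming (branch to ψ; injective to ψ-injective; path to Q;
              isPath to Q-isPath; disjoint to Q-disjoint)

  top : Fin (suc t)
  top = fromℕ t

  ψ₀≢ψsuc : ∀ {b : Fin r} → ψ Fin.zero ≢ ψ (Fin.suc b)
  ψ₀≢ψsuc = 0≢1+n ∘ ψ-injective

  toTop : (a : Fin (suc t)) → Walk G (φ a) (φ top)
  toTop a with a Fin.≟ top
  ... | yes refl = here
  ... | no  a≢top = P a top (≤∧≢⇒< (≤fromℕ a) a≢top)

  toTop-isPath : ∀ a → IsPath G (toTop a)
  toTop-isPath a with a Fin.≟ top
  ... | yes refl = here-isPath G
  ... | no  a≢top = P-isPath a top _

  toTop-disjoint : ∀ a c → a ≢ c → EdgeDisjoint G (toTop a) (toTop c)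
  toTop-disjoint a c a≢c with a Fin.≟ top | c Fin.≟ top
  ... | yes refl | _        = λ ()
  ... | no  _    | yes refl = λ _ ()
  ... | no  _    | no  _    =
    P-disjoint a top c top _ _ λ (a≡c , _) → a≢c a≡c

  branch : Fin (suc t) ⊎ Fin r → V (G □ H)
  branch (inj₁ a) = (φ a , ψ Fin.zero)
  branch (inj₂ b) = (φ top , ψ (Fin.suc b))

  branch-injective : Injective _≡_ _≡_ branch
  branch-injective {inj₁ a} {inj₁ c} eq = cong inj₁ (φ-injective (cong proj₁ eq))
  branch-injective {inj₁ a} {inj₂ d} eq = ⊥-elim (ψ₀≢ψsuc (cong proj₂ eq))
  branch-injective {inj₂ b} {inj₁ c} eq = ⊥-elim (ψ₀≢ψsuc (≡-sym (cong proj₂ eq)))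
  branch-injective {inj₂ b} {inj₂ d} eq =
    cong inj₂ (suc-injective (ψ-injective (cong proj₂ eq)))

  rowPath : ∀ a b → a Fin.< b → Walk (G □ H) (branch (inj₁ a)) (branch (inj₁ b))
  rowPath a b a<b = inRow (ψ Fin.zero) (P a b a<b)

  columnPath : ∀ a b → a Fin.< b → Walk (G □ H) (branch (inj₂ a)) (branch (inj₂ b))
  columnPath a b a<b = inColumn (φ top) (Q (Fin.suc a) (Fin.suc b) (s<s a<b))

  bridge : ∀ a b → Walk (G □ H) (branch (inj₁ a)) (branch (inj₂ b))
  bridge a b = _++ʷ_ (G □ H) (inColumn (φ a) (Q Fin.zero (Fin.suc b) z<s))
                             (inRow (ψ (Fin.suc b)) (toTop a))

  path : ∀ i j → i <⊎ j → Walk (G □ H) (branch i) (branch j)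
  path (inj₁ a) (inj₁ b) (₁∼₁ a<b) = rowPath a b a<b
  path (inj₂ a) (inj₂ b) (₂∼₂ a<b) = columnPath a b a<b
  path (inj₁ a) (inj₂ b) ₁∼₂       = bridge a b

  isPath : ∀ i j (i<j : i <⊎ j) → IsPath (G □ H) (path i j i<j)
  isPath (inj₁ a) (inj₁ b) (₁∼₁ a<b) = inRow-isPath _ _ (P-isPath a b a<b)
  isPath (inj₂ a) (inj₂ b) (₂∼₂ a<b) = inColumn-isPath _ _ (Q-isPath _ _ _)
  isPath (inj₁ a) (inj₂ b) ₁∼₂       =
    corner-isPath _ (toTop a) (Q-isPath _ _ _) (toTop-isPath a)

  row-bridge : ∀ a b c d (a<b : a Fin.< b) →
    EdgeDisjoint (G □ H) (rowPath a b a<b) (bridge c d)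
  row-bridge a b c d a<b =
    ++-disjointʳ (G □ H) (rowPath a b a<b) _ _
      (row-column-disjoint (P a b a<b) _)
      (rows-disjoint (P a b a<b) (toTop c) (⊥-elim ∘ ψ₀≢ψsuc))

  column-bridge : ∀ a b c d (a<b : a Fin.< b) →
    EdgeDisjoint (G □ H) (columnPath a b a<b) (bridge c d)
  column-bridge a b c d a<b =
    ++-disjointʳ (G □ H) (columnPath a b a<b) _ _
      (columns-disjoint _ _ λ _ →
        Q-disjoint _ _ _ _ _ _ λ { (() , _) })
      (EdgeDisjoint-sym (G □ H) _ _ (row-column-disjoint (toTop c) _))

  -- Two bridges share a column only if they start at the same a, and then
  -- their H-parts are distinct Q-paths; they share a row only if they end
  -- at the same b, and then their G-parts are distinct P-paths.
  bridge-bridge : ∀ a b c d → ¬ (a ≡ c × b ≡ d) →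
    EdgeDisjoint (G □ H) (bridge a b) (bridge c d)
  bridge-bridge a b c d distinct =
    ++-disjointˡ (G □ H) _ _ (bridge c d)
      (++-disjointʳ (G □ H) _ _ _
        (columns-disjoint _ _ λ φa≡φc →
          Q-disjoint _ _ _ _ _ _ λ (_ , b+1≡d+1) →
            distinct (φ-injective φa≡φc , suc-injective b+1≡d+1))
        (EdgeDisjoint-sym (G □ H) _ _ (row-column-disjoint (toTop c) _)))
      (++-disjointʳ (G □ H) _ _ _
        (row-column-disjoint (toTop a) _)
        (rows-disjoint (toTop a) (toTop c) λ ψb≡ψd →
          toTop-disjoint a c λ a≡c →
            distinct (a≡c , suc-injective (ψ-injective ψb≡ψd))))

  disjoint : ∀ i j k l (i<j : i <⊎ j) (k<l : k <⊎ l) → ¬ (i ≡ k × j ≡ l) →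
    EdgeDisjoint (G □ H) (path i j i<j) (path k l k<l)
  disjoint (inj₁ a) (inj₁ b) (inj₁ c) (inj₁ d) (₁∼₁ a<b) (₁∼₁ c<d) distinct =
    rows-disjoint _ _ λ _ →
      P-disjoint a b c d a<b c<d λ { (refl , refl) → distinct (refl , refl) }
  disjoint (inj₂ a) (inj₂ b) (inj₂ c) (inj₂ d) (₂∼₂ a<b) (₂∼₂ c<d) distinct =
    columns-disjoint _ _ λ _ →
      Q-disjoint _ _ _ _ _ _ λ { (refl , refl) → distinct (refl , refl) }
  disjoint (inj₁ a) (inj₂ b) (inj₁ c) (inj₂ d) ₁∼₂ ₁∼₂ distinct =
    bridge-bridge a b c d λ { (refl , refl) → distinct (refl , refl) }
  disjoint (inj₁ a) (inj₁ b) (inj₂ c) (inj₂ d) (₁∼₁ a<b) (₂∼₂ c<d) _ =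
    row-column-disjoint _ _
  disjoint (inj₂ a) (inj₂ b) (inj₁ c) (inj₁ d) (₂∼₂ a<b) (₁∼₁ c<d) _ =
    EdgeDisjoint-sym (G □ H) _ _ (row-column-disjoint _ _)
  disjoint (inj₁ a) (inj₁ b) (inj₁ c) (inj₂ d) (₁∼₁ a<b) ₁∼₂ _ =
    row-bridge a b c d a<b
  disjoint (inj₁ a) (inj₂ b) (inj₁ c) (inj₁ d) ₁∼₂ (₁∼₁ c<d) _ =
    EdgeDisjoint-sym (G □ H) _ _ (row-bridge c d a b c<d)
  disjoint (inj₂ a) (inj₂ b) (inj₁ c) (inj₂ d) (₂∼₂ a<b) ₁∼₂ _ =
    column-bridge a b c d a<b
  disjoint (inj₁ a) (inj₂ b) (inj₂ c) (inj₂ d) ₁∼₂ (₂∼₂ c<d) _ =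
    EdgeDisjoint-sym (G □ H) _ _ (column-bridge c d a b c<d)

  immersion : Immersion (G □ H) (Fin (suc t) ⊎ Fin r) _<⊎_
  immersion = record { branch = branch ; injective = branch-injective
                     ; path = path ; isPath = isPath ; disjoint = disjoint }

product-immersion : ∀ {G H t r} → HasImmersion G (suc t) → HasImmersion H (suc r) →
  HasImmersion (G □ H) (suc t + r)
product-immersion {t = t} immG immH =
  toHasImmersion (reindex (splitAt (suc t)) (splitAt-injective (suc t))
    (splitAt-monotone (suc t))
    (Construction.immersion (fromHasImmersion immG) (fromHasImmersion immH)))

theorem9 : (G H : Graph) (t r : ℕ) → size G > 0 → size H > 0 →
    ImmersionNumber G t → ImmersionNumber H r →
    ∀ s → ImmersionNumber (G □ H) s → t + r ∸ 1 ≤ s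
theorem9 G H t r G-nonempty H-nonempty (immG , maxG) (immH , maxH) s (_ , maxGH) =
  bound (maxG 1 (K₁-immersion G G-nonempty)) (maxH 1 (K₁-immersion H H-nonempty))
    immG immH
  where
  bound : ∀ {t r} → 1 ≤ t → 1 ≤ r → HasImmersion G t → HasImmersion H r →
    t + r ∸ 1 ≤ s
  bound {suc t'} {suc r'} _ _ immG' immH' =
    subst (_≤ s) (≡-sym (+-suc t' r')) (maxGH _ (product-immersion immG' immH'))
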